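{- Let $D=(V,E)$ be a digraph on $V=\{1,\dots,n\}$, $p\ge1$, $\alpha=\alpha_p(D)$, and let $W_i=(w_{i,0},\dots,w_{i,p})$, $1\le i\le\alpha$, be pairwise independent $p$-walks of $D$ such that whenever a vertex occurs as $w_{i,s}$ and as $w_{j,t}$ with $s,t\ge1$, then $w_{i,s-1}=w_{j,t-1}$. Let $W^s=\{w_{i,s}:1\le i\le\alpha\}$ and $U'=V\setminus(W^1\cup\dots\cup W^p)$. Define $f:\{0,1\}^n\to\{0,1\}^n$ by $f_{w_{i,s+1}}(x)=x_{w_{i,s}}$ for $0\le s\le p-1$, $1\le i\le\alpha$, and $f_u(x)=0$ for $u\in U'$. Then $f\in F(D,2)$ and $\operatorname{ima}(f^p)=\alpha_p(D)$.
   Context: A $p$-walk is a sequence $(v_0,\dots,v_p)$ of vertices with $(v_s,v_{s+1})\in E$; two $p$-walks $(w_s),(w'_s)$ are independent if $w_s\ne w'_s$ for all $0\le s\le p$; $\alpha_p(D)$ is the maximum number of pairwise independent $p$-walks. For $f:[q]^n\to[q]^n$ with $[q]=\{0,\dots,q-1\}$, $\mathrm{IG}(f)$ is the digraph on $V$ with $(u,v)$ an arc iff $f_v$ depends essentially on $x_u$; $F(D,q)=\{f:\mathrm{IG}(f)\subseteq D\}$. $\operatorname{ima}(g)=\log_q|\mathrm{Im}(g)|$ (here $q=2$). -}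

module Defs where

open import Level using (0ℓ)
open import Data.Nat using (ℕ; zero; suc; _≤_)
open import Data.Fin using (Fin; zero; suc; inject₁) renaming (_≟_ to _≟ᶠ_)
open import Data.Fin.Base using () 
open import Data.Bool using (Bool; true; false; not)
open import Data.Vec using (Vec; []; _∷_; lookup; tabulate; _[_]≔_)
open import Data.Vec.Properties using (≡-dec)
open import Data.List using (List; []; _∷_; _++_; map; concatMap; length; filter; allFin; findᵇ)
open import Data.List.Relation.Unary.Any using (any?)
import Data.Bool.Properties as BP
open import Data.Maybe using (Maybe; just; nothing)
import Data.Maybe as M
open import Data.Product using (Σ; _×_; _,_; ∃)
open import Relation.Binary using (Rel)
open import Relation.Binary.PropositionalEquality using (_≡_; _≢_)
open import Relation.Nullary.Decidable using (⌊_⌋)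
open import Function using (_∘_)

Digraph : ℕ → Set₁
Digraph n = Rel (Fin n) 0ℓ

record Walk {n : ℕ} (D : Digraph n) (p : ℕ) : Set where
  field
    vtx : Fin (suc p) → Fin n
    arc : (s : Fin p) → D (vtx (inject₁ s)) (vtx (suc s))
open Walk public

Independent : ∀ {n} {D : Digraph n} {p} → Walk D p → Walk D p → Set
Independent W W' = ∀ s → vtx W s ≢ vtx W' s

PairwiseIndependent : ∀ {n} {D : Digraph n} {p m} → (Fin m → Walk D p) → Set
PairwiseIndependent {m = m} W = ∀ (i j : Fin m) → i ≢ j → Independent (W i) (W j)

IsAlpha : ∀ {n} → Digraph n → ℕ → ℕ → Set
IsAlpha D p α =
  (Σ (Fin α → Walk D p) PairwiseIndependent) ×
  (∀ m → (W : Fin m → Walk D p) → PairwiseIndependent W → m ≤ α)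

State : ℕ → Set
State n = Vec Bool n

BN : ℕ → Set
BN n = State n → State n

DependsOn : ∀ {n} → BN n → Fin n → Fin n → Set
DependsOn f u v = ∃ λ (x : State n) →
  lookup (f x) v ≢ lookup (f (x [ u ]≔ not (lookup x u))) v
  where n = _

InF : ∀ {n} → Digraph n → BN n → Set
InF D f = ∀ u v → DependsOn f u v → D u v

allStates : (n : ℕ) → List (State n)
allStates zero = [] ∷ []
allStates (suc n) = map (false ∷_) (allStates n) ++ map (true ∷_) (allStates n)

imageSize : ∀ {n} → BN n → ℕ
imageSize {n} g =
  length (filter (λ y → any? (λ x → ≡-dec BP._≟_ (g x) y) (allStates n)) (allStates n))

iterate : ∀ {n} → BN n → ℕ → BN n
iterate g zero = λ x → x
iterate g (suc k) = g ∘ iterate g k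

-- For vertex v, the predecessor w_{i,s-1} of some occurrence v = w_{i,s}, s ≥ 1
-- (the first one found; by the hypothesis of the lemma all choices agree).
predOf : ∀ {n α p} → (Fin α → Fin (suc p) → Fin n) → Fin n → Maybe (Fin n)
predOf {n} {α} {p} w v =
  M.map (λ is → w (Data.Product.proj₁ is) (inject₁ (Data.Product.proj₂ is)))
    (findᵇ (λ is → ⌊ w (Data.Product.proj₁ is) (suc (Data.Product.proj₂ is)) ≟ᶠ v ⌋)
           (concatMap (λ i → map (i ,_) (allFin p)) (allFin α)))

walkNet : ∀ {n α p} → (Fin α → Fin (suc p) → Fin n) → BN n
walkNet w x = tabulate λ v → go (predOf w v)
  where
  go : Maybe _ → Bool
  go (just u) = lookup x u
  go nothing = false

-- Let π v be the predecessor of v on the walks (undefined on U′). The network copies x along π, so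
-- (f^k x)_v is x at π^k v, or 0 where π^k v is undefined; in particular f_v can only depend on
-- x at π v, and (π v, v) is an arc of some W_i. By the consistency hypothesis each W_i is a π-chain,
-- every π-chain of length p is a p-walk, and two π-chains that meet agree back to their origins;
-- so maximality of α forces every defined π^p v to be an origin w_{i,0}. Hence f^p x depends only
-- on the α bits x_{w_{i,0}}, while (f^p x)_{w_{i,p}} = x_{w_{i,0}} recovers them all.
module Submission where

open import Defs
open import Data.Bool using (Bool; true; false; not; T)
import Data.Bool.Properties as Bool
open import Data.Empty using (⊥-elim)
open import Data.Fin using (Fin; zero; suc; inject₁; fromℕ) renaming (_≟_ to _≟ᶠ_)
open import Data.Fin.Properties using () renaming (any? to anyFin?)
open import Data.List using (List; []; _∷_; _++_; map; concatMap; length; filter; allFin; findᵇ)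
open import Data.List.Properties using (length-map; length-++)
open import Data.List.Relation.Unary.All using ([])
open import Data.List.Relation.Unary.AllPairs using ([]; _∷_)
open import Data.List.Relation.Unary.Any using (Any; here; there; any?; satisfied)
open import Data.List.Membership.Propositional using (_∈_; lose)
open import Data.List.Membership.Propositional.Properties
  using (∈-map⁺; ∈-map⁻; ∈-++⁺ˡ; ∈-++⁺ʳ; ∈-filter⁺; ∈-filter⁻; ∈-concatMap⁺; ∈-allFin)
open import Data.List.Membership.Propositional.Properties.WithK using (unique∧set⇒bag)
open import Data.List.Relation.Unary.Unique.Propositional using (Unique)
import Data.List.Relation.Unary.Unique.Propositional.Properties as Unique
open import Data.List.Relation.Binary.BagAndSetEquality using (_∼[_]_; set; ∼bag⇒↭)
open import Data.List.Relation.Binary.Permutation.Propositional.Properties using (↭-length)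
open import Data.Maybe using (Maybe; just; nothing; maybe′; _>>=_)
open import Data.Nat using (ℕ; zero; suc; _≤_; _^_; _+_)
open import Data.Nat.Properties using (+-identityʳ; <-irrefl)
open import Data.Product using (_×_; _,_; ∃; ∃₂; proj₂)
open import Data.Vec using (Vec; []; _∷_; lookup; tabulate; _[_]≔_)
open import Data.Vec.Properties using (≡-dec; ∷-injectiveʳ; lookup∘tabulate; lookup∘update′)
open import Data.Vec.Relation.Binary.Pointwise.Extensional using (ext; Pointwise-≡⇒≡)
open import Function using (_∘_)
open import Function.Bundles using (mk⇔)
open import Relation.Nullary using (yes; no; ¬_)
open import Relation.Unary using (Decidable)
open import Relation.Nullary.Decidable using (⌊_⌋; toWitness; fromWitness)
open import Relation.Binary.PropositionalEquality
  using (_≡_; _≢_; refl; sym; trans; cong; cong₂; subst; module ≡-Reasoning)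
open ≡-Reasoning

allStates-complete : ∀ {m} (x : State m) → x ∈ allStates m
allStates-complete [] = here refl
allStates-complete {suc m} (false ∷ x) = ∈-++⁺ˡ (∈-map⁺ (false ∷_) (allStates-complete x))
allStates-complete {suc m} (true ∷ x) =
  ∈-++⁺ʳ (map (false ∷_) (allStates m)) (∈-map⁺ (true ∷_) (allStates-complete x))

allStates-unique : ∀ m → Unique (allStates m)
allStates-unique zero = [] ∷ []
allStates-unique (suc m) =
  Unique.++⁺ (Unique.map⁺ ∷-injectiveʳ (allStates-unique m))
             (Unique.map⁺ ∷-injectiveʳ (allStates-unique m))
             heads-differ
  where
  heads-differ : ∀ {x} → ¬ (x ∈ map (false ∷_) (allStates m) × x ∈ map (true ∷_) (allStates m))
  heads-differ (x∈₀ , x∈₁) with ∈-map⁻ (false ∷_) x∈₀ | ∈-map⁻ (true ∷_) x∈₁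
  ... | _ , _ , refl | _ , _ , ()

length-allStates : ∀ m → length (allStates m) ≡ 2 ^ m
length-allStates zero = refl
length-allStates (suc m) = begin
  length (map (false ∷_) (allStates m) ++ map (true ∷_) (allStates m))
    ≡⟨ length-++ (map (false ∷_) (allStates m)) ⟩
  length (map (false ∷_) (allStates m)) + length (map (true ∷_) (allStates m))
    ≡⟨ cong₂ _+_ (length-map (false ∷_) (allStates m)) (length-map (true ∷_) (allStates m)) ⟩
  length (allStates m) + length (allStates m)
    ≡⟨ cong (λ k → k + k) (length-allStates m) ⟩
  2 ^ m + 2 ^ m
    ≡⟨ cong (2 ^ m +_) (sym (+-identityʳ (2 ^ m))) ⟩
  2 ^ suc m ∎

imageSize-transversal : ∀ {m n} (g : BN n) (s : State m → State n) →
  (∀ {a b} → g (s a) ≡ g (s b) → a ≡ b) → (∀ x → ∃ λ b → g x ≡ g (s b)) →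
  imageSize g ≡ 2 ^ m
imageSize-transversal {m} {n} g s injective covering = begin
  length image                      ≡⟨ ↭-length (∼bag⇒↭ (unique∧set⇒bag image-unique transversal-unique same-elements)) ⟩
  length (map (g ∘ s) (allStates m)) ≡⟨ length-map (g ∘ s) (allStates m) ⟩
  length (allStates m)               ≡⟨ length-allStates m ⟩
  2 ^ m                              ∎
  where
  hit? : Decidable (λ y → Any (λ x → g x ≡ y) (allStates n))
  hit? y = any? (λ x → ≡-dec Bool._≟_ (g x) y) (allStates n)

  image : List (State n)
  image = filter hit? (allStates n)

  image-unique : Unique image
  image-unique = Unique.filter⁺ hit? (allStates-unique n)

  transversal-unique : Unique (map (g ∘ s) (allStates m))
  transversal-unique = Unique.map⁺ injective (allStates-unique m)

  image⊆ : ∀ {y} → y ∈ image → y ∈ map (g ∘ s) (allStates m)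
  image⊆ y∈ with satisfied (proj₂ (∈-filter⁻ hit? {xs = allStates n} y∈))
  ... | x , refl with covering x
  ...   | b , gx≡gsb = subst (_∈ map (g ∘ s) (allStates m)) (sym gx≡gsb) (∈-map⁺ (g ∘ s) (allStates-complete b))

  ⊆image : ∀ {y} → y ∈ map (g ∘ s) (allStates m) → y ∈ image
  ⊆image {y} y∈ with ∈-map⁻ (g ∘ s) y∈
  ... | b , _ , y≡gsb = ∈-filter⁺ hit? (allStates-complete y) (lose (allStates-complete (s b)) (sym y≡gsb))

  same-elements : image ∼[ set ] map (g ∘ s) (allStates m)
  same-elements = mk⇔ image⊆ ⊆image

findᵇ-sound : ∀ {A : Set} (q : A → Bool) xs {a} → findᵇ q xs ≡ just a → T (q a)
findᵇ-sound q (x ∷ xs) found with q x in qx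
findᵇ-sound q (x ∷ xs) refl | true = subst T (sym qx) _
... | false = findᵇ-sound q xs found

findᵇ-complete : ∀ {A : Set} (q : A → Bool) xs {a} → a ∈ xs → T (q a) → ∃ λ b → findᵇ q xs ≡ just b
findᵇ-complete q (x ∷ xs) a∈ qa with q x in qx
... | true = x , refl
findᵇ-complete q (x ∷ xs) (here refl) qa | false = ⊥-elim (subst T qx qa)
findᵇ-complete q (x ∷ xs) (there a∈) qa | false = findᵇ-complete q xs a∈ qa

iterate-suc : ∀ {n} (g : BN n) k x → iterate g (suc k) x ≡ iterate g k (g x)
iterate-suc g zero x = refl
iterate-suc g (suc k) x = cong g (iterate-suc g k x)

iterateᴹ : ∀ {A : Set} → (A → Maybe A) → ℕ → A → Maybe A
iterateᴹ π zero a = just a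
iterateᴹ π (suc k) a = iterateᴹ π k a >>= π

-- π points backwards along a chain: k steps of π lead from its end c (fromℕ k) to its origin c zero.
Chain : ∀ {A : Set} → (A → Maybe A) → (k : ℕ) → (Fin (suc k) → A) → Set
Chain π k c = ∀ (s : Fin k) → π (c (suc s)) ≡ just (c (inject₁ s))

module _ {A : Set} (π : A → Maybe A) where

  iterateᴹ-just⇒Chain : ∀ k {a b} → iterateᴹ π k a ≡ just b →
                        ∃ λ c → Chain π k c × c zero ≡ b
  iterateᴹ-just⇒Chain zero {a} refl = (λ _ → a) , (λ ()) , refl
  iterateᴹ-just⇒Chain (suc k) {a} {b} eq with iterateᴹ π k a in eqₖ
  ... | just b′ with iterateᴹ-just⇒Chain k eqₖ
  ...   | c , chain , c₀≡b′ = c′ , chain′ , refl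
    where
    c′ : Fin (suc (suc k)) → A
    c′ zero = b
    c′ (suc s) = c s
    chain′ : Chain π (suc k) c′
    chain′ zero = trans (cong π c₀≡b′) eq
    chain′ (suc s) = chain s

  Chain⇒iterateᴹ-just : ∀ k {c} → Chain π k c → iterateᴹ π k (c (fromℕ k)) ≡ just (c zero)
  Chain⇒iterateᴹ-just zero chain = refl
  Chain⇒iterateᴹ-just (suc k) {c} chain
    rewrite Chain⇒iterateᴹ-just k {c ∘ suc} (chain ∘ suc) = chain zero

  -- π is single-valued, so agreement at s propagates back one step at a time.
  Chain-meet⇒origin : ∀ k {c c′} → Chain π k c → Chain π k c′ → ∀ s → c s ≡ c′ s → c zero ≡ c′ zero
  Chain-meet⇒origin k       chain chain′ zero    eq = eq
  Chain-meet⇒origin (suc k) chain chain′ (suc s) eq =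
    Chain-meet⇒origin k (chain ∘ inject₁) (chain′ ∘ inject₁) s
      (just-injective (trans (sym (chain s)) (trans (cong π eq) (chain′ s))))
    where
    just-injective : ∀ {x y : A} → just x ≡ just y → x ≡ y
    just-injective refl = refl

read : ∀ {n} → State n → Maybe (Fin n) → Bool
read x = maybe′ (lookup x) false

module _ {n α p : ℕ} (w : Fin α → Fin (suc p) → Fin n) where

  steps : List (Fin α × Fin p)
  steps = concatMap (λ i → map (i ,_) (allFin p)) (allFin α)

  steps-into : Fin n → Fin α × Fin p → Bool
  steps-into v (i , t) = ⌊ w i (suc t) ≟ᶠ v ⌋

  ∈-steps : ∀ i t → (i , t) ∈ steps
  ∈-steps i t = ∈-concatMap⁺ (λ i → map (i ,_) (allFin p)) (lose (∈-allFin i) (∈-map⁺ (i ,_) (∈-allFin t)))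

  -- The case function inside walkNet cannot be named here, so this statement (that it agrees with
  -- read x at predOf w v) is inferred from its use in lookup-walkNet.
  walkNet-cases : (x : State n) (v : Fin n) → _

  lookup-walkNet : ∀ x v → lookup (walkNet w x) v ≡ read x (predOf w v)
  lookup-walkNet x v = trans (lookup∘tabulate _ v) (walkNet-cases x v)

  walkNet-cases x v with predOf w v
  ... | just u = refl
  ... | nothing = refl

  read-walkNet : ∀ x m → read (walkNet w x) m ≡ read x (m >>= predOf w)
  read-walkNet x (just u) = lookup-walkNet x u
  read-walkNet x nothing = refl

  lookup-iterate-walkNet : ∀ k x v → lookup (iterate (walkNet w) k x) v ≡ read x (iterateᴹ (predOf w) k v)
  lookup-iterate-walkNet zero x v = refl
  lookup-iterate-walkNet (suc k) x v = begin
    lookup (iterate (walkNet w) (suc k) x) v      ≡⟨ cong (λ y → lookup y v) (iterate-suc (walkNet w) k x) ⟩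
    lookup (iterate (walkNet w) k (walkNet w x)) v ≡⟨ lookup-iterate-walkNet k (walkNet w x) v ⟩
    read (walkNet w x) (iterateᴹ (predOf w) k v)   ≡⟨ read-walkNet x (iterateᴹ (predOf w) k v) ⟩
    read x (iterateᴹ (predOf w) (suc k) v)         ∎

  dependsOn-walkNet⇒predOf : ∀ {u v} → DependsOn (walkNet w) u v → predOf w v ≡ just u
  dependsOn-walkNet⇒predOf {u} {v} (x , differs) = only-u-is-read (predOf w v) reads-differ
    where
    x′ : State n
    x′ = x [ u ]≔ not (lookup x u)

    reads-differ : read x (predOf w v) ≢ read x′ (predOf w v)
    reads-differ eq = differs (trans (lookup-walkNet x v) (trans eq (sym (lookup-walkNet x′ v))))

    only-u-is-read : ∀ m → read x m ≢ read x′ m → m ≡ just u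
    only-u-is-read nothing differ = ⊥-elim (differ refl)
    only-u-is-read (just u′) differ with u′ ≟ᶠ u
    ... | yes u′≡u = cong just u′≡u
    ... | no u′≢u = ⊥-elim (differ (sym (lookup∘update′ u′≢u x _)))

  predOf-sound : ∀ {u v} → predOf w v ≡ just u → ∃₂ λ i t → w i (suc t) ≡ v × w i (inject₁ t) ≡ u
  predOf-sound {v = v} found with findᵇ (steps-into v) steps in eq
  predOf-sound {v = v} refl | just (i , t) = i , t , toWitness (findᵇ-sound (steps-into v) steps eq) , refl

module _ {n p α : ℕ} {D : Digraph n} (W : Fin α → Walk D p) where

  private
    w : Fin α → Fin (suc p) → Fin n
    w i = vtx (W i)

  predOf⇒arc : ∀ {u v} → predOf w v ≡ just u → D u v
  predOf⇒arc found with predOf-sound w found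
  ... | i , t , refl , refl = arc (W i) t

  walkNet-InF : InF D (walkNet w)
  walkNet-InF u v = predOf⇒arc ∘ dependsOn-walkNet⇒predOf w

  Chain⇒Walk : ∀ {c} → Chain (predOf w) p c → Walk D p
  Chain⇒Walk {c} chain = record { vtx = c ; arc = predOf⇒arc ∘ chain }

  module _ (consistent : ∀ i j s t → w i (suc s) ≡ w j (suc t) → w i (inject₁ s) ≡ w j (inject₁ t)) where

    -- predOf answers with the first step (j , s) into w i (suc t) it finds; consistency makes it agree with W i.
    walk-Chain : ∀ i → Chain (predOf w) p (w i)
    walk-Chain i t with findᵇ-complete (steps-into w (w i (suc t))) (steps w) (∈-steps w i t) (fromWitness refl)
    ... | (j , s) , found rewrite found =
      cong just (consistent j i s t (toWitness (findᵇ-sound (steps-into w (w i (suc t))) (steps w) found)))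

    module _ (independent : PairwiseIndependent W)
             (maximal : ∀ m (W′ : Fin m → Walk D p) → PairwiseIndependent W′ → m ≤ α) where

      origin-injective : ∀ {i j} → w i zero ≡ w j zero → i ≡ j
      origin-injective {i} {j} eq with i ≟ᶠ j
      ... | yes i≡j = i≡j
      ... | no i≢j = ⊥-elim (independent i j i≢j zero eq)

      -- A chain from any other origin would be a walk independent of all W i, one too many.
      Chain-origin : ∀ {c} → Chain (predOf w) p c → ∃ λ i → w i zero ≡ c zero
      Chain-origin {c} chain with anyFin? (λ i → w i zero ≟ᶠ c zero)
      ... | yes origin = origin
      ... | no not-origin = ⊥-elim (<-irrefl refl (maximal (suc α) extended extended-independent))
        where
        extended : Fin (suc α) → Walk D p
        extended zero = Chain⇒Walk {c} chain
        extended (suc i) = W i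

        avoids : ∀ i s → w i s ≢ c s
        avoids i s meet = not-origin (i , Chain-meet⇒origin (predOf w) p {w i} (walk-Chain i) chain s meet)

        extended-independent : PairwiseIndependent extended
        extended-independent zero    zero    0≢0 = ⊥-elim (0≢0 refl)
        extended-independent zero    (suc j) _ s = avoids j s ∘ sym
        extended-independent (suc i) zero    _   = avoids i
        extended-independent (suc i) (suc j) i≢j = independent i j (i≢j ∘ cong suc)

      iterateᴹ-origin : ∀ {u v} → iterateᴹ (predOf w) p v ≡ just u → ∃ λ i → w i zero ≡ u
      iterateᴹ-origin found with iterateᴹ-just⇒Chain (predOf w) p found
      ... | c , chain , refl = Chain-origin {c} chain

      origins : State n → Vec Bool α
      origins x = tabulate λ i → lookup x (w i zero)

      seed-at : Vec Bool α → Fin n → Bool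
      seed-at b u with anyFin? (λ i → w i zero ≟ᶠ u)
      ... | yes (i , _) = lookup b i
      ... | no _ = false

      seed : Vec Bool α → State n
      seed b = tabulate (seed-at b)

      lookup-seed-origin : ∀ b i → lookup (seed b) (w i zero) ≡ lookup b i
      lookup-seed-origin b i = trans (lookup∘tabulate (seed-at b) (w i zero)) seed-at-origin
        where
        seed-at-origin : seed-at b (w i zero) ≡ lookup b i
        seed-at-origin with anyFin? (λ j → w j zero ≟ᶠ w i zero)
        ... | yes (j , eq) = cong (lookup b) (origin-injective eq)
        ... | no not-origin = ⊥-elim (not-origin (i , refl))

      iterate-walkNet-agree : ∀ {x y} → (∀ i → lookup x (w i zero) ≡ lookup y (w i zero)) →
                              iterate (walkNet w) p x ≡ iterate (walkNet w) p y
      iterate-walkNet-agree {x} {y} agree = Pointwise-≡⇒≡ (ext λ v →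
        trans (lookup-iterate-walkNet w p x v)
          (trans (reads-agree (iterateᴹ (predOf w) p v) refl) (sym (lookup-iterate-walkNet w p y v))))
        where
        reads-agree : ∀ {v} m → iterateᴹ (predOf w) p v ≡ m → read x m ≡ read y m
        reads-agree nothing _ = refl
        reads-agree (just u) found with iterateᴹ-origin found
        ... | i , refl = agree i

      lookup-iterate-walkNet-end : ∀ b i → lookup (iterate (walkNet w) p (seed b)) (w i (fromℕ p)) ≡ lookup b i
      lookup-iterate-walkNet-end b i = begin
        lookup (iterate (walkNet w) p (seed b)) (w i (fromℕ p)) ≡⟨ lookup-iterate-walkNet w p (seed b) (w i (fromℕ p)) ⟩
        read (seed b) (iterateᴹ (predOf w) p (w i (fromℕ p)))    ≡⟨ cong (read (seed b)) (Chain⇒iterateᴹ-just (predOf w) p {w i} (walk-Chain i)) ⟩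
        lookup (seed b) (w i zero)                               ≡⟨ lookup-seed-origin b i ⟩
        lookup b i                                               ∎

      imageSize-iterate-walkNet : imageSize (iterate (walkNet w) p) ≡ 2 ^ α
      imageSize-iterate-walkNet = imageSize-transversal (iterate (walkNet w) p) seed injective covering
        where
        injective : ∀ {a b} → iterate (walkNet w) p (seed a) ≡ iterate (walkNet w) p (seed b) → a ≡ b
        injective {a} {b} eq = Pointwise-≡⇒≡ (ext λ i →
          trans (sym (lookup-iterate-walkNet-end a i))
            (trans (cong (λ y → lookup y (w i (fromℕ p))) eq) (lookup-iterate-walkNet-end b i)))

        covering : ∀ x → ∃ λ b → iterate (walkNet w) p x ≡ iterate (walkNet w) p (seed b)
        covering x = origins x , iterate-walkNet-agree λ i →
          sym (trans (lookup-seed-origin (origins x) i) (lookup∘tabulate _ i))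

lemma2 : (n : ℕ) (D : Digraph n) (p : ℕ) → 1 ≤ p → (α : ℕ) → IsAlpha D p α →
         (W : Fin α → Walk D p) → PairwiseIndependent W →
         (∀ (i j : Fin α) (s t : Fin p) →
            vtx (W i) (suc s) ≡ vtx (W j) (suc t) →
            vtx (W i) (inject₁ s) ≡ vtx (W j) (inject₁ t)) →
         InF D (walkNet (λ i → vtx (W i)))
           × imageSize (iterate (walkNet (λ i → vtx (W i))) p) ≡ 2 ^ α
lemma2 n D p _ α (_ , maximal) W independent consistent =
  walkNet-InF W , imageSize-iterate-walkNet W consistent independent maximal
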